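{- If $MPF$ is a valley-marked parking function of size $n$ with $k$ marked valleys, then $$\operatorname{area}(MPF) + \operatorname{dinv}(MPF) + \binom{k+1}{2} \leq \binom{n}{2}.$$
   Context: A Dyck path of size $n$ goes from $(0,0)$ to $(n,n)$ with unit North/East steps weakly above $y=x$; a parking function of size $n$ is such a path with $n$ distinct positive integer cars placed one in the cell immediately right of each North step, increasing upward in each column. The cell with lower-left corner $(i,j)$ lies in the $(j-i)$-diagonal; left/right for cars refers to columns. $\operatorname{area}$ is the number of full cells between the path and $y=x$. A valley is an East step immediately followed by a North step such that the cell directly below the East step has no car or has a car smaller than the car next to that North step. A valley-marked parking function is a parking function with a subset of its valleys marked; the car next to a marked valley's North step is marked. For cars $s<b$: a primary diagonal inversion occurs if $s,b$ are in the same diagonal, $s$ is to the left of $b$, and $s$ is unmarked; a secondary diagonal inversion occurs if $b$ is in the diagonal one above $s$'s, $b$ is to the left of $s$, and $b$ is unmarked. $\operatorname{dinv}$ is the number of primary and secondary diagonal inversions minus the number of marked valleys. -}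

module Defs where

open import Data.Bool using (Bool; true; false; _∧_; not; T)
open import Data.Nat using (ℕ; zero; suc; _+_; _∸_; _≤_; _<_; _<ᵇ_; _≡ᵇ_)
open import Data.Nat.Combinatorics using (_C_)
open import Data.Fin using (Fin; toℕ)
open import Data.List using (List; []; _∷_; length; take; filterᵇ; allFin; map; cartesianProduct)
open import Data.Nat.ListAction using (sum)
open import Data.Product using (_×_; _,_; Σ)
open import Data.Sum using (_⊎_)
open import Data.Integer as ℤ using (ℤ; +_)
open import Function.Definitions using (Injective)
open import Relation.Binary.PropositionalEquality using (_≡_; _≢_)

data Step : Set where
  N E : Step

numN : List Step → ℕ
numN [] = 0
numN (N ∷ w) = suc (numN w)
numN (E ∷ w) = numN w

numE : List Step → ℕ
numE [] = 0
numE (N ∷ w) = numE w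
numE (E ∷ w) = suc (numE w)

-- A Dyck path of size n from (0,0) to (n,n): n North and n East steps,
-- every prefix ends at a point (x,y) with y ≥ x (weakly above y = x).
record IsDyck (n : ℕ) (w : List Step) : Set where
  field
    northCount : numN w ≡ n
    eastCount  : numE w ≡ n
    above      : ∀ p → numE (take p w) ≤ numN (take p w)

-- x-coordinates of the North steps, listed bottom to top
-- (the r-th North step goes from (a_r, r) to (a_r, r+1)).
colsFrom : ℕ → List Step → List ℕ
colsFrom x [] = []
colsFrom x (N ∷ w) = x ∷ colsFrom x w
colsFrom x (E ∷ w) = colsFrom (suc x) w

at : List ℕ → ℕ → ℕ
at [] _ = 0
at (x ∷ xs) zero = x
at (x ∷ xs) (suc r) = at xs r

-- A parking function of size n.  Row r (0-based, r < n) contains the r-th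
-- North step; its car sits in the cell with lower-left corner (col r, r).
record ParkingFunction (n : ℕ) : Set where
  field
    path     : List Step
    isDyck   : IsDyck n path
    car      : Fin n → ℕ
    carPos   : ∀ i → 1 ≤ car i
    carInj   : Injective _≡_ _≡_ car
  col : Fin n → ℕ
  col i = at (colsFrom 0 path) (toℕ i)
  diag : Fin n → ℕ
  diag i = toℕ i ∸ col i
  field
    colIncr  : ∀ i j → toℕ i < toℕ j → col i ≡ col j → car i < car j

-- Row j is a valley: its North step is immediately preceded by an East step
-- (i.e. row j-1 exists and its North step lies strictly to the left), and the
-- cell directly below that East step (lower-left corner (col j - 1, j - 1))
-- has no car (col (j-1) ≢ col j - 1) or has a car smaller than car j.
IsValley : ∀ {n} → ParkingFunction n → Fin n → Set
IsValley {n} P j =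
  Σ (Fin n) λ i → toℕ j ≡ suc (toℕ i)
     × col i < col j
     × (suc (col i) ≢ col j ⊎ car i < car j)
  where
    open ParkingFunction P

-- A valley-marked parking function: a parking function with a subset of its
-- valleys marked (marked j = true means the valley at row j is marked, and
-- hence car j is marked).
record ValleyMarkedPF (n : ℕ) : Set where
  field
    pf       : ParkingFunction n
    marked   : Fin n → Bool
    markedOK : ∀ j → T (marked j) → IsValley pf j
  open ParkingFunction pf public

  count : ∀ {A : Set} → (A → Bool) → List A → ℕ
  count p xs = length (filterᵇ p xs)

  numMarked : ℕ
  numMarked = count marked (allFin n)

  -- area: full cells between the path and y = x; row r contributes r - col r
  area : ℕ
  area = sum (map diag (allFin n))

  pairs : List (Fin n × Fin n)
  pairs = cartesianProduct (allFin n) (allFin n)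

  primary : Fin n × Fin n → Bool
  primary (i , j) = (car i <ᵇ car j) ∧ (diag i ≡ᵇ diag j) ∧ (col i <ᵇ col j) ∧ not (marked i)

  secondary : Fin n × Fin n → Bool
  secondary (i , j) = (car i <ᵇ car j) ∧ (diag j ≡ᵇ suc (diag i)) ∧ (col j <ᵇ col i) ∧ not (marked j)

  dinv : ℤ
  dinv = (+ (count primary pairs + count secondary pairs)) ℤ.- (+ numMarked)

module Submission where

-- Number the rows of the parking function 0, …, n-1 from the bottom; row t
-- has column c t and diagonal d t = t - c t, and area = Σ_t d t.  Fix a row t
-- and look at the rows r < t below it.  They fall into three disjoint classes:
--   lower : r unmarked and d r < d t,
--   near  : r unmarked and d r ∈ {d t, d t + 1},
--   marked: r marked,
-- so |lower| + |near| + |marked| ≤ t.  Moreover |lower| ≥ d t: the diagonal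
-- starts at 0 and rises by at most one per row, so each value v < d t is the
-- diagonal of a row r < t at which it rises by exactly one; such a row sits
-- directly above the previous North step, so it is no valley and is unmarked.
-- Summing over t: area + #near pairs + #marked pairs ≤ n C 2.  A primary
-- inversion (r,t) or a secondary inversion (t,r) is a near pair (r,t), never
-- both; and k marked rows give at least k C 2 marked pairs.  As
-- dinv = #inversions - k and (k+1) C 2 = k + k C 2, the theorem follows.

open import Defs
open import Data.Bool using (Bool; true; false; _∧_; _∨_; not; T)
open import Data.Bool.Properties using (T-∧; T-∨)
open import Data.Nat using (ℕ; zero; suc; _+_; _∸_; _≤_; _<_; _<ᵇ_; _≡ᵇ_; z≤n; s≤s; _≤?_)
open import Data.Nat.Properties
open import Algebra.Properties.CommutativeSemigroup +-commutativeSemigroup using (interchange)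
open import Data.Nat.Combinatorics using (_C_; nCk+nC[k+1]≡[n+1]C[k+1]; nC1≡n)
open import Data.Nat.ListAction using (sum)
open import Data.Nat.ListAction.Properties using (sum-++)
open import Data.Fin using (Fin; toℕ; fromℕ<) renaming (zero to fzero; suc to fsuc)
open import Data.Fin.Properties using (toℕ-fromℕ<; toℕ<n)
open import Data.List using (List; []; _∷_; _++_; length; take; filterᵇ; allFin; map; cartesianProduct)
open import Data.List.Properties using (map-++; map-tabulate)
open import Data.List.Membership.Propositional using (_∈_)
open import Data.List.Membership.Propositional.Properties using (∈-allFin)
open import Data.List.Relation.Unary.Any using (here; there)
open import Data.Product using (_×_; _,_; Σ)
open import Data.Sum using (inj₁; inj₂)
open import Data.Unit using (⊤; tt)
open import Data.Empty using (⊥; ⊥-elim)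
open import Data.Integer as ℤ using (ℤ; +_; +≤+)
open import Data.Integer.Solver using (module +-*-Solver)
open import Function using (_∘_)
open import Function.Bundles using (Equivalence)
open import Relation.Nullary using (yes; no)
open import Relation.Binary.PropositionalEquality

⟦_⟧ : Bool → ℕ
⟦ true ⟧ = 1
⟦ false ⟧ = 0

T-∧-intro : ∀ {a b} → T a → T b → T (a ∧ b)
T-∧-intro ta tb = Equivalence.from T-∧ (ta , tb)

T⇒1≤indicator : ∀ {b} → T b → 1 ≤ ⟦ b ⟧
T⇒1≤indicator {true} _ = ≤-refl

T-∧₄ : ∀ {a b c d} → T (a ∧ b ∧ c ∧ d) → T a × T b × T c × T d
T-∧₄ {true} {true} {true} {true} _ = tt , tt , tt , tt
T-∧₄ {false} ()
T-∧₄ {true} {false} ()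
T-∧₄ {true} {true} {false} ()
T-∧₄ {true} {true} {true} {false} ()

exclusive-indicators : ∀ a b d → (T a → T d) → (T b → T d) → (T a → T b → ⊥) →
  ⟦ a ⟧ + ⟦ b ⟧ ≤ ⟦ d ⟧
exclusive-indicators true true d ad bd ab = ⊥-elim (ab tt tt)
exclusive-indicators true false d ad bd ab with d | ad tt
... | true | _ = ≤-refl
exclusive-indicators false true d ad bd ab with d | bd tt
... | true | _ = ≤-refl
exclusive-indicators false false d ad bd ab = z≤n

partition-indicators : ∀ a b x y → ⟦ x ⟧ + ⟦ y ⟧ ≤ 1 →
  ⟦ (a ∧ not b) ∧ x ⟧ + ⟦ (a ∧ not b) ∧ y ⟧ + ⟦ a ∧ b ⟧ ≤ ⟦ a ⟧
partition-indicators false b x y h = z≤n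
partition-indicators true true x y h = s≤s z≤n
partition-indicators true false x y h = ≤-trans (≤-reflexive (+-identityʳ _)) h

below-excludes-near : ∀ a b → ⟦ a <ᵇ b ⟧ + ⟦ (a ≡ᵇ b) ∨ (a ≡ᵇ suc b) ⟧ ≤ 1
below-excludes-near zero zero = s≤s z≤n
below-excludes-near zero (suc b) = s≤s z≤n
below-excludes-near (suc a) zero with a ≡ᵇ 0
... | true = s≤s z≤n
... | false = z≤n
below-excludes-near (suc a) (suc b) = below-excludes-near a b

indicator-<-suc : ∀ P a m → ⟦ P ∧ (a <ᵇ suc m) ⟧ ≡ ⟦ P ∧ (a <ᵇ m) ⟧ + ⟦ P ∧ (a ≡ᵇ m) ⟧
indicator-<-suc false a m = refl
indicator-<-suc true zero zero = refl
indicator-<-suc true zero (suc m) = refl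
indicator-<-suc true (suc a) zero = refl
indicator-<-suc true (suc a) (suc m) = indicator-<-suc true a m

suc-C-2 : ∀ k → suc k C 2 ≡ k + k C 2
suc-C-2 k = trans (sym (nCk+nC[k+1]≡[n+1]C[k+1] k 1)) (cong (_+ k C 2) (nC1≡n k))

sumOver : {A : Set} → List A → (A → ℕ) → ℕ
sumOver xs f = sum (map f xs)

module _ {A : Set} where

  sumOver-++ : (xs ys : List A) (f : A → ℕ) → sumOver (xs ++ ys) f ≡ sumOver xs f + sumOver ys f
  sumOver-++ xs ys f = trans (cong sum (map-++ f xs ys)) (sum-++ (map f xs) (map f ys))

  sumOver-+ : (xs : List A) (f g : A → ℕ) → sumOver xs (λ x → f x + g x) ≡ sumOver xs f + sumOver xs g
  sumOver-+ [] f g = refl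
  sumOver-+ (x ∷ xs) f g =
    trans (cong (_+_ (f x + g x)) (sumOver-+ xs f g)) (interchange (f x) (g x) _ _)

  sumOver-cong : (xs : List A) (f g : A → ℕ) → (∀ x → f x ≡ g x) → sumOver xs f ≡ sumOver xs g
  sumOver-cong [] f g h = refl
  sumOver-cong (x ∷ xs) f g h = cong₂ _+_ (h x) (sumOver-cong xs f g h)

  sumOver-mono : (xs : List A) (f g : A → ℕ) → (∀ x → f x ≤ g x) → sumOver xs f ≤ sumOver xs g
  sumOver-mono [] f g h = z≤n
  sumOver-mono (x ∷ xs) f g h = +-mono-≤ (h x) (sumOver-mono xs f g h)

  sumOver-zero : (xs : List A) → sumOver xs (λ _ → 0) ≡ 0
  sumOver-zero [] = refl
  sumOver-zero (x ∷ xs) = sumOver-zero xs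

  term≤sumOver : (xs : List A) (f : A → ℕ) {x : A} → x ∈ xs → f x ≤ sumOver xs f
  term≤sumOver (y ∷ xs) f (here refl) = m≤m+n (f y) _
  term≤sumOver (y ∷ xs) f (there x∈xs) = ≤-trans (term≤sumOver xs f x∈xs) (m≤n+m _ (f y))

  count≡sumOver : (p : A → Bool) (xs : List A) → length (filterᵇ p xs) ≡ sumOver xs (⟦_⟧ ∘ p)
  count≡sumOver p [] = refl
  count≡sumOver p (x ∷ xs) with p x
  ... | true = cong suc (count≡sumOver p xs)
  ... | false = count≡sumOver p xs

sumOver-map : {A B : Set} (h : A → B) (xs : List A) (f : B → ℕ) → sumOver (map h xs) f ≡ sumOver xs (f ∘ h)
sumOver-map h [] f = refl
sumOver-map h (x ∷ xs) f = cong (_+_ (f (h x))) (sumOver-map h xs f)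

module _ {A B : Set} where

  sumOver-swap : (xs : List A) (ys : List B) (f : A → B → ℕ) →
    sumOver xs (λ x → sumOver ys (f x)) ≡ sumOver ys (λ y → sumOver xs (λ x → f x y))
  sumOver-swap [] ys f = sym (sumOver-zero ys)
  sumOver-swap (x ∷ xs) ys f = trans (cong (_+_ (sumOver ys (f x))) (sumOver-swap xs ys f))
    (sym (sumOver-+ ys (f x) (λ y → sumOver xs (λ x′ → f x′ y))))

  sumOver-cartesian : (xs : List A) (ys : List B) (f : A × B → ℕ) →
    sumOver (cartesianProduct xs ys) f ≡ sumOver xs (λ x → sumOver ys (λ y → f (x , y)))
  sumOver-cartesian [] ys f = refl
  sumOver-cartesian (x ∷ xs) ys f = begin
    sumOver (map (x ,_) ys ++ cartesianProduct xs ys) f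
      ≡⟨ sumOver-++ (map (x ,_) ys) (cartesianProduct xs ys) f ⟩
    sumOver (map (x ,_) ys) f + sumOver (cartesianProduct xs ys) f
      ≡⟨ cong₂ _+_ (sumOver-map (x ,_) ys f) (sumOver-cartesian xs ys f) ⟩
    sumOver ys (λ y → f (x , y)) + sumOver xs (λ x′ → sumOver ys (λ y → f (x′ , y))) ∎
    where open ≡-Reasoning

covering-count : ∀ {A : Set} (xs : List A) (P : A → Bool) (g : A → ℕ) (m : ℕ) →
  (∀ v → v < m → Σ A λ x → x ∈ xs × T (P x) × g x ≡ v) →
  m ≤ sumOver xs (λ x → ⟦ P x ∧ (g x <ᵇ m) ⟧)
covering-count xs P g zero covers = z≤n
covering-count xs P g (suc m) covers with covers m ≤-refl
... | x , x∈xs , Px , gx≡m = begin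
  suc m
    ≡⟨ +-comm 1 m ⟩
  m + 1
    ≤⟨ +-mono-≤ (covering-count xs P g m (λ v v<m → covers v (m<n⇒m<1+n v<m))) hit ⟩
  sumOver xs (λ x → ⟦ P x ∧ (g x <ᵇ m) ⟧) + sumOver xs (λ x → ⟦ P x ∧ (g x ≡ᵇ m) ⟧)
    ≡⟨ sumOver-+ xs _ _ ⟨
  sumOver xs (λ x → ⟦ P x ∧ (g x <ᵇ m) ⟧ + ⟦ P x ∧ (g x ≡ᵇ m) ⟧)
    ≡⟨ sumOver-cong xs _ _ (λ y → indicator-<-suc (P y) (g y) m) ⟨
  sumOver xs (λ x → ⟦ P x ∧ (g x <ᵇ suc m) ⟧) ∎
  where
  open ≤-Reasoning
  hit : 1 ≤ sumOver xs (λ x → ⟦ P x ∧ (g x ≡ᵇ m) ⟧)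
  hit = ≤-trans (T⇒1≤indicator (T-∧-intro Px (≡⇒≡ᵇ (g x) m gx≡m)))
              (term≤sumOver xs (λ x → ⟦ P x ∧ (g x ≡ᵇ m) ⟧) x∈xs)

sumFin : (n : ℕ) → (Fin n → ℕ) → ℕ
sumFin n = sumOver (allFin n)

sumFin-suc : ∀ n (f : Fin (suc n) → ℕ) → sumFin (suc n) f ≡ f fzero + sumFin n (f ∘ fsuc)
sumFin-suc n f =
  cong (λ fs → f fzero + sum fs) (trans (map-tabulate fsuc f) (sym (map-tabulate (λ i → i) (f ∘ fsuc))))

sumFin-one : ∀ n → sumFin n (λ _ → 1) ≡ n
sumFin-one zero = refl
sumFin-one (suc n) = trans (sumFin-suc n (λ _ → 1)) (cong suc (sumFin-one n))

sumFin-indicator≤ : ∀ n (p : Fin n → Bool) → sumFin n (⟦_⟧ ∘ p) ≤ n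
sumFin-indicator≤ n p =
  ≤-trans (sumOver-mono (allFin n) _ _ (λ x → indicator≤1 (p x))) (≤-reflexive (sumFin-one n))
  where
  indicator≤1 : ∀ b → ⟦ b ⟧ ≤ 1
  indicator≤1 true = s≤s z≤n
  indicator≤1 false = z≤n

sumFin-below≤ : ∀ n m → sumFin n (λ r → ⟦ toℕ r <ᵇ m ⟧) ≤ m
sumFin-below≤ zero m = z≤n
sumFin-below≤ (suc n) zero =
  ≤-reflexive (trans (sumFin-suc n (λ r → ⟦ toℕ r <ᵇ 0 ⟧)) (sumOver-zero (allFin n)))
sumFin-below≤ (suc n) (suc m) =
  ≤-trans (≤-reflexive (sumFin-suc n (λ r → ⟦ toℕ r <ᵇ suc m ⟧))) (s≤s (sumFin-below≤ n m))

sumFin-toℕ : ∀ n → sumFin n toℕ ≡ n C 2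
sumFin-toℕ zero = refl
sumFin-toℕ (suc n) = begin
  sumFin (suc n) toℕ                       ≡⟨ sumFin-suc n toℕ ⟩
  sumFin n (λ i → 1 + toℕ i)               ≡⟨ sumOver-+ (allFin n) (λ _ → 1) toℕ ⟩
  sumFin n (λ _ → 1) + sumFin n toℕ        ≡⟨ cong₂ _+_ (sumFin-one n) (sumFin-toℕ n) ⟩
  n + n C 2                                ≡⟨ suc-C-2 n ⟨
  suc n C 2                                ∎
  where open ≡-Reasoning

pairsAbove : (n : ℕ) → (Fin n → Bool) → ℕ
pairsAbove n p = sumFin n (λ t → sumFin n (λ r → ⟦ (toℕ r <ᵇ toℕ t) ∧ p r ⟧))

-- Peeling off the bottom element: it lies below each of the n others.
pairsAbove-suc : ∀ n (p : Fin (suc n) → Bool) →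
  pairsAbove (suc n) p ≡ sumFin n (λ _ → ⟦ p fzero ⟧) + pairsAbove n (p ∘ fsuc)
pairsAbove-suc n p = begin
  pairsAbove (suc n) p
    ≡⟨ sumFin-suc n _ ⟩
  sumFin (suc n) (λ r → ⟦ (toℕ r <ᵇ 0) ∧ p r ⟧) + sumFin n (λ t → sumFin (suc n) (λ r → pairIndicator r (fsuc t)))
    ≡⟨ cong₂ _+_ (sumOver-zero (allFin (suc n))) (sumOver-cong (allFin n) _ _ (λ t → sumFin-suc n (λ r → pairIndicator r (fsuc t)))) ⟩
  sumFin n (λ t → ⟦ p fzero ⟧ + sumFin n (λ r → pairIndicator (fsuc r) (fsuc t)))
    ≡⟨ sumOver-+ (allFin n) _ _ ⟩
  sumFin n (λ _ → ⟦ p fzero ⟧) + pairsAbove n (p ∘ fsuc) ∎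
  where
  open ≡-Reasoning
  pairIndicator : Fin (suc n) → Fin (suc n) → ℕ
  pairIndicator r t = ⟦ (toℕ r <ᵇ toℕ t) ∧ p r ⟧

-- A k-element subset p of Fin n has at least k C 2 pairs r < t with r ∈ p:
-- the i-th element of p from the top lies below at least i others.
pairsAbove-bound : ∀ n (p : Fin n → Bool) → sumFin n (⟦_⟧ ∘ p) C 2 ≤ pairsAbove n p
pairsAbove-bound zero p = z≤n
pairsAbove-bound (suc n) p rewrite pairsAbove-suc n p | sumFin-suc n (⟦_⟧ ∘ p) with p fzero
... | false = ≤-trans (pairsAbove-bound n (p ∘ fsuc)) (m≤n+m _ (sumFin n (λ _ → 0)))
... | true = begin
  suc k C 2                                   ≡⟨ suc-C-2 k ⟩
  k + k C 2                                   ≤⟨ +-mono-≤ k≤n (pairsAbove-bound n (p ∘ fsuc)) ⟩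
  sumFin n (λ _ → 1) + pairsAbove n (p ∘ fsuc) ∎
  where
  open ≤-Reasoning
  k : ℕ
  k = sumFin n (⟦_⟧ ∘ p ∘ fsuc)
  k≤n : k ≤ sumFin n (λ _ → 1)
  k≤n = ≤-trans (sumFin-indicator≤ n (p ∘ fsuc)) (≤-reflexive (sym (sumFin-one n)))

-- Discrete intermediate values.  Index r climbs in d if d rises by exactly one
-- on reaching r (index 0 counts as climbing).
Climbs : (ℕ → ℕ) → ℕ → Set
Climbs d zero = ⊤
Climbs d (suc r) = d (suc r) ≡ suc (d r)

climbing-witness : (n : ℕ) (d : ℕ → ℕ) → d 0 ≡ 0 → (∀ r → suc r < n → d (suc r) ≤ suc (d r)) →
  ∀ j → j < n → ∀ v → v ≤ d j → Σ ℕ λ r → r ≤ j × d r ≡ v × Climbs d r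
climbing-witness n d d0≡0 step zero j<n v v≤d0 =
  0 , z≤n , trans d0≡0 (sym (n≤0⇒n≡0 (subst (v ≤_) d0≡0 v≤d0))) , tt
climbing-witness n d d0≡0 step (suc j) j<n v v≤d[1+j] with v ≤? d j
... | yes v≤dj with climbing-witness n d d0≡0 step j (<⇒≤ j<n) v v≤dj
...   | r , r≤j , dr≡v , climbs = r , m≤n⇒m≤1+n r≤j , dr≡v , climbs
climbing-witness n d d0≡0 step (suc j) j<n v v≤d[1+j] | no v≰dj =
  suc j , ≤-refl , sym v≡d[1+j] , climbs
  where
  dj<v : d j < v
  dj<v = ≰⇒> v≰dj
  v≡d[1+j] : v ≡ d (suc j)
  v≡d[1+j] = ≤-antisym v≤d[1+j] (≤-trans (step j j<n) dj<v)
  climbs : d (suc j) ≡ suc (d j)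
  climbs = ≤-antisym (step j j<n) (subst (suc (d j) ≤_) v≡d[1+j] dj<v)

northStep-prefix : ∀ x w r → r < numN w →
  Σ ℕ λ p → numN (take p w) ≡ r × x + numE (take p w) ≡ at (colsFrom x w) r
northStep-prefix x (N ∷ w) zero r<n = 0 , refl , +-identityʳ x
northStep-prefix x (N ∷ w) (suc r) (s≤s r<n) with northStep-prefix x w r r<n
... | p , north , east = suc p , cong suc north , east
northStep-prefix x (E ∷ w) r r<n with northStep-prefix (suc x) w r r<n
... | p , north , east = suc p , north , trans (+-suc x _) east

column≥start : ∀ x w r → r < numN w → x ≤ at (colsFrom x w) r
column≥start x (N ∷ w) zero r<n = ≤-refl
column≥start x (N ∷ w) (suc r) (s≤s r<n) = column≥start x w r r<n
column≥start x (E ∷ w) r r<n = ≤-trans (n≤1+n x) (column≥start (suc x) w r r<n)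

column-mono : ∀ x w r → suc r < numN w → at (colsFrom x w) r ≤ at (colsFrom x w) (suc r)
column-mono x (N ∷ w) zero (s≤s r<n) = column≥start x w 0 r<n
column-mono x (N ∷ w) (suc r) (s≤s r<n) = column-mono x w r r<n
column-mono x (E ∷ w) r r<n = column-mono (suc x) w r r<n

module RowCounting {n : ℕ} (M : ValleyMarkedPF n) where
  open ValleyMarkedPF M
  open IsDyck isDyck

  column : ℕ → ℕ
  column = at (colsFrom 0 path)

  diagonal : ℕ → ℕ
  diagonal r = r ∸ column r

  column≤row : ∀ r → r < n → column r ≤ r
  column≤row r r<n with northStep-prefix 0 path r (subst (r <_) (sym northCount) r<n)
  ... | p , north , east = subst₂ _≤_ east north (above p)

  row≡diag+col : ∀ (i : Fin n) → diag i + col i ≡ toℕ i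
  row≡diag+col i = m∸n+n≡m (column≤row (toℕ i) (toℕ<n i))

  diagonal-step : ∀ r → suc r < n → diagonal (suc r) ≤ suc (diagonal r)
  diagonal-step r r+1<n = ≤-trans
    (∸-monoʳ-≤ (suc r) (column-mono 0 path r (subst (suc r <_) (sym northCount) r+1<n)))
    (≤-reflexive (+-∸-assoc 1 (column≤row r (<⇒≤ r+1<n))))

  east-before-not-climbing : ∀ r → column r < column (suc r) → Climbs diagonal (suc r) → ⊥
  east-before-not-climbing r rise climbs = 1+n≰n (subst (_≤ diagonal r) climbs (∸-monoʳ-≤ (suc r) rise))

  -- Hence a climbing row is no valley, and so it is unmarked.
  climbing-row-unmarked : ∀ (i : Fin n) → Climbs diagonal (toℕ i) → marked i ≡ false
  climbing-row-unmarked i climbs with marked i in eq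
  ... | false = refl
  ... | true with markedOK i (subst T (sym eq) tt)
  ...   | i′ , i≡1+i′ , east , _ = ⊥-elim (east-before-not-climbing (toℕ i′)
            (subst (λ r → column (toℕ i′) < column r) i≡1+i′ east) (subst (Climbs diagonal) i≡1+i′ climbs))

  below : Fin n → Fin n → Bool
  below r t = toℕ r <ᵇ toℕ t

  belowUnmarked : Fin n → Fin n → Bool
  belowUnmarked r t = below r t ∧ not (marked r)

  lower-diagonals-covered : ∀ (t : Fin n) v → v < diag t →
    Σ (Fin n) λ r → r ∈ allFin n × T (belowUnmarked r t) × diag r ≡ v
  lower-diagonals-covered t v v<dt
    with climbing-witness n diagonal (0∸n≡0 (column 0)) diagonal-step (toℕ t) (toℕ<n t) v (<⇒≤ v<dt)
  ... | r , r≤t , dr≡v , climbs = fromℕ< r<n , ∈-allFin _ , T-∧-intro isBelow isUnmarked , trans (cong diagonal r≡) dr≡v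
    where
    r<t : r < toℕ t
    r<t = ≤∧≢⇒< r≤t (λ { refl → <-irrefl (sym dr≡v) v<dt })
    r<n : r < n
    r<n = <-trans r<t (toℕ<n t)
    r≡ : toℕ (fromℕ< r<n) ≡ r
    r≡ = toℕ-fromℕ< r<n
    isBelow : T (below (fromℕ< r<n) t)
    isBelow = <⇒<ᵇ (subst (_< toℕ t) (sym r≡) r<t)
    isUnmarked : T (not (marked (fromℕ< r<n)))
    isUnmarked rewrite climbing-row-unmarked (fromℕ< r<n) (subst (Climbs diagonal) (sym r≡) climbs) = tt

  lowerRow nearRow markedRow : Fin n → Fin n → Bool
  lowerRow r t = belowUnmarked r t ∧ (diag r <ᵇ diag t)
  nearRow r t = belowUnmarked r t ∧ ((diag r ≡ᵇ diag t) ∨ (diag r ≡ᵇ suc (diag t)))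
  markedRow r t = below r t ∧ marked r

  -- The per-row inequality: diag t + |near| + |marked| ≤ |lower| + |near| + |marked| ≤ t.
  row-inequality : ∀ t → diag t + (sumFin n (λ r → ⟦ nearRow r t ⟧) + sumFin n (λ r → ⟦ markedRow r t ⟧)) ≤ toℕ t
  row-inequality t = begin
    diag t + (Near + Marked)
      ≤⟨ +-monoˡ-≤ _ (covering-count (allFin n) (λ r → belowUnmarked r t) diag (diag t) (lower-diagonals-covered t)) ⟩
    Lower + (Near + Marked)
      ≡⟨ +-assoc Lower Near Marked ⟨
    Lower + Near + Marked
      ≡⟨ cong (_+ Marked) (sumOver-+ (allFin n) _ _) ⟨
    sumFin n (λ r → ⟦ lowerRow r t ⟧ + ⟦ nearRow r t ⟧) + Marked
      ≡⟨ sumOver-+ (allFin n) _ _ ⟨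
    sumFin n (λ r → ⟦ lowerRow r t ⟧ + ⟦ nearRow r t ⟧ + ⟦ markedRow r t ⟧)
      ≤⟨ sumOver-mono (allFin n) _ _ (λ r → partition-indicators (below r t) (marked r) _ _ (below-excludes-near (diag r) (diag t))) ⟩
    sumFin n (λ r → ⟦ below r t ⟧)
      ≤⟨ sumFin-below≤ n (toℕ t) ⟩
    toℕ t ∎
    where
    open ≤-Reasoning
    Lower Near Marked : ℕ
    Lower = sumFin n (λ r → ⟦ lowerRow r t ⟧)
    Near = sumFin n (λ r → ⟦ nearRow r t ⟧)
    Marked = sumFin n (λ r → ⟦ markedRow r t ⟧)

  nearPairs : ℕ
  nearPairs = sumFin n (λ t → sumFin n (λ r → ⟦ nearRow r t ⟧))

  rows-inequality : area + (nearPairs + pairsAbove n marked) ≤ n C 2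
  rows-inequality = begin
    area + (nearPairs + pairsAbove n marked)
      ≡⟨ cong (_+_ area) (sumOver-+ (allFin n) _ _) ⟨
    area + sumFin n (λ t → sumFin n (λ r → ⟦ nearRow r t ⟧) + sumFin n (λ r → ⟦ markedRow r t ⟧))
      ≡⟨ sumOver-+ (allFin n) diag _ ⟨
    sumFin n (λ t → diag t + (sumFin n (λ r → ⟦ nearRow r t ⟧) + sumFin n (λ r → ⟦ markedRow r t ⟧)))
      ≤⟨ sumOver-mono (allFin n) _ _ row-inequality ⟩
    sumFin n toℕ
      ≡⟨ sumFin-toℕ n ⟩
    n C 2 ∎
    where open ≤-Reasoning

  same-diagonal-lower : ∀ r t → diag r ≡ diag t → col r < col t → toℕ r < toℕ t
  same-diagonal-lower r t dr≡dt cr<ct = subst₂ _<_ (row≡diag+col r) (row≡diag+col t)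
    (subst (λ z → z + col r < diag t + col t) (sym dr≡dt) (+-monoʳ-< (diag t) cr<ct))

  next-diagonal-lower : ∀ r t → diag r ≡ suc (diag t) → col r < col t → toℕ r < toℕ t
  next-diagonal-lower r t dr≡1+dt cr<ct = ≤∧≢⇒< r≤t r≢t
    where
    r≤t : toℕ r ≤ toℕ t
    r≤t = subst₂ _≤_ (row≡diag+col r) (row≡diag+col t) (subst (λ z → z + col r ≤ diag t + col t) (sym dr≡1+dt)
            (≤-trans (≤-reflexive (sym (+-suc (diag t) (col r)))) (+-monoʳ-≤ (diag t) cr<ct)))
    r≢t : toℕ r ≢ toℕ t
    r≢t r≡t = 1+n≰n (≤-reflexive (trans (sym dr≡1+dt) (cong diagonal r≡t)))

  primary-parts : ∀ r t → T (primary (r , t)) →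
    car r < car t × diag r ≡ diag t × col r < col t × T (not (marked r))
  primary-parts r t inv with T-∧₄ {car r <ᵇ car t} {diag r ≡ᵇ diag t} {col r <ᵇ col t} inv
  ... | cars , same , left , unmarked =
    <ᵇ⇒< (car r) (car t) cars , ≡ᵇ⇒≡ (diag r) (diag t) same , <ᵇ⇒< (col r) (col t) left , unmarked

  secondary-parts : ∀ t r → T (secondary (t , r)) →
    car t < car r × diag r ≡ suc (diag t) × col r < col t × T (not (marked r))
  secondary-parts t r inv with T-∧₄ {car t <ᵇ car r} {diag r ≡ᵇ suc (diag t)} {col r <ᵇ col t} inv
  ... | cars , next , left , unmarked =
    <ᵇ⇒< (car t) (car r) cars , ≡ᵇ⇒≡ (diag r) (suc (diag t)) next , <ᵇ⇒< (col r) (col t) left , unmarked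

  -- A primary inversion (r, t) and a secondary inversion (t, r) each make
  -- (r, t) a near pair, and they exclude each other (car r < car t or not).
  inversions-near : ∀ r t → ⟦ primary (r , t) ⟧ + ⟦ secondary (t , r) ⟧ ≤ ⟦ nearRow r t ⟧
  inversions-near r t = exclusive-indicators (primary (r , t)) (secondary (t , r)) (nearRow r t) fromPrimary fromSecondary exclusive
    where
    near : toℕ r < toℕ t → T (not (marked r)) → T ((diag r ≡ᵇ diag t) ∨ (diag r ≡ᵇ suc (diag t))) → T (nearRow r t)
    near r<t unmarked close = T-∧-intro (T-∧-intro (<⇒<ᵇ r<t) unmarked) close
    fromPrimary : T (primary (r , t)) → T (nearRow r t)
    fromPrimary inv with primary-parts r t inv
    ... | _ , same , left , unmarked = near (same-diagonal-lower r t same left) unmarked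
                                         (Equivalence.from T-∨ (inj₁ (≡⇒≡ᵇ (diag r) (diag t) same)))
    fromSecondary : T (secondary (t , r)) → T (nearRow r t)
    fromSecondary inv with secondary-parts t r inv
    ... | _ , next , left , unmarked = near (next-diagonal-lower r t next left) unmarked
                                         (Equivalence.from T-∨ (inj₂ (≡⇒≡ᵇ (diag r) (suc (diag t)) next)))
    exclusive : T (primary (r , t)) → T (secondary (t , r)) → ⊥
    exclusive inv₁ inv₂ with primary-parts r t inv₁ | secondary-parts t r inv₂
    ... | r<t , _ | t<r , _ = <-asym r<t t<r

  inversions≤nearPairs : count primary pairs + count secondary pairs ≤ nearPairs
  inversions≤nearPairs = begin
    count primary pairs + count secondary pairs
      ≡⟨ cong₂ _+_ (trans (count≡sumOver primary pairs) (sumOver-cartesian (allFin n) (allFin n) _))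
                   (trans (trans (count≡sumOver secondary pairs) (sumOver-cartesian (allFin n) (allFin n) _))
                          (sumOver-swap (allFin n) (allFin n) (λ t r → ⟦ secondary (t , r) ⟧))) ⟩
    sumFin n (λ r → sumFin n (λ t → ⟦ primary (r , t) ⟧)) + sumFin n (λ r → sumFin n (λ t → ⟦ secondary (t , r) ⟧))
      ≡⟨ sumOver-+ (allFin n) _ _ ⟨
    sumFin n (λ r → sumFin n (λ t → ⟦ primary (r , t) ⟧) + sumFin n (λ t → ⟦ secondary (t , r) ⟧))
      ≤⟨ sumOver-mono (allFin n) _ _ (λ r → ≤-trans (≤-reflexive (sym (sumOver-+ (allFin n) _ _)))
                                                   (sumOver-mono (allFin n) _ _ (inversions-near r))) ⟩
    sumFin n (λ r → sumFin n (λ t → ⟦ nearRow r t ⟧))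
      ≡⟨ sumOver-swap (allFin n) (allFin n) (λ r t → ⟦ nearRow r t ⟧) ⟩
    nearPairs ∎
    where open ≤-Reasoning

  main-inequality : area + (count primary pairs + count secondary pairs) + numMarked C 2 ≤ n C 2
  main-inequality = begin
    area + (count primary pairs + count secondary pairs) + numMarked C 2
      ≤⟨ +-mono-≤ (+-monoʳ-≤ area inversions≤nearPairs) markedPairs ⟩
    area + nearPairs + pairsAbove n marked
      ≡⟨ +-assoc area nearPairs _ ⟩
    area + (nearPairs + pairsAbove n marked)
      ≤⟨ rows-inequality ⟩
    n C 2 ∎
    where
    open ≤-Reasoning
    markedPairs : numMarked C 2 ≤ pairsAbove n marked
    markedPairs = subst (λ k → k C 2 ≤ pairsAbove n marked) (sym (count≡sumOver marked (allFin n)))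
                        (pairsAbove-bound n marked)

regroup : ∀ (a x k c : ℤ) → a ℤ.+ (x ℤ.- k) ℤ.+ (k ℤ.+ c) ≡ a ℤ.+ x ℤ.+ c
regroup = solve 4 (λ a x k c → a :+ (x :- k) :+ (k :+ c) := a :+ x :+ c) refl
  where open +-*-Solver

-- Theorem 4.7: with dinv = #inversions - k and (k + 1) C 2 = k + k C 2, the
-- left-hand side is the natural number bounded in main-inequality.
theorem4p7 : (n k : ℕ) (M : ValleyMarkedPF n) → ValleyMarkedPF.numMarked M ≡ k →
    (+ ValleyMarkedPF.area M) ℤ.+ ValleyMarkedPF.dinv M ℤ.+ (+ (suc k C 2)) ℤ.≤ + (n C 2)
theorem4p7 n k M refl = subst (ℤ._≤ + (n C 2)) (sym dinv-unfolded) (+≤+ (RowCounting.main-inequality M))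
  where
  open ValleyMarkedPF M
  inversions : ℕ
  inversions = count primary pairs + count secondary pairs
  dinv-unfolded : (+ area) ℤ.+ dinv ℤ.+ (+ (suc numMarked C 2)) ≡ + (area + inversions + numMarked C 2)
  dinv-unfolded = begin
    (+ area) ℤ.+ dinv ℤ.+ (+ (suc numMarked C 2))
      ≡⟨ cong (λ z → (+ area) ℤ.+ dinv ℤ.+ (+ z)) (suc-C-2 numMarked) ⟩
    (+ area) ℤ.+ ((+ inversions) ℤ.- (+ numMarked)) ℤ.+ (+ numMarked ℤ.+ + (numMarked C 2))
      ≡⟨ regroup (+ area) (+ inversions) (+ numMarked) (+ (numMarked C 2)) ⟩
    + (area + inversions + numMarked C 2) ∎
    where open ≡-Reasoning
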